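{- Let $G=(V,E,w)$ be a weighted graph, $k\ge 1$, and $f$ a positive integer. Let $H$ be the output of the Light Fault-Tolerant Greedy Spanner Algorithm on input $(G,k,f)$. Then $H$ is an $f$-EFT $k$-spanner of $G$.
   Context: An edge-subgraph $H$ of $G$ is an $f$-EFT $k$-spanner of $G$ if $\mathrm{dist}_{H\setminus F}(u,v)\le k\cdot \mathrm{dist}_{G\setminus F}(u,v)$ for all $u,v\in V$ and all $F\subseteq E$ with $|F|\le f$. A subgraph $Q\subseteq G$ is an $f'$-EFT connectivity preserver if for every $F\subseteq E$ with $|F|\le f'$, the connected components of $Q\setminus F$ equal those of $G\setminus F$. Light Fault-Tolerant Greedy Spanner Algorithm on input $(G,k,f)$: let $Q$ be a minimum-weight $2f$-EFT connectivity preserver of $G$; initialize $H\leftarrow Q$; then for each edge $(u,v)\in E(G)\setminus Q$ in order of nondecreasing weight, add $(u,v)$ to $H$ if and only if there exists $F\subseteq E(H)$ with $|F|\le f$ such that $\mathrm{dist}_{H\setminus F}(u,v)>k\cdot w(u,v)$ (with $H$ the current graph); return $H$.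
   Formalization: The edge weights and the stretch $k$ take values in the rationals. -}

module Defs where

open import Data.Nat as ℕ using (ℕ; zero; suc)
open import Data.Fin using (Fin)
import Data.Fin as Fin
open import Data.Fin.Subset using (Subset; _∈_; _∉_; _⊆_; ∁; _∩_; _∪_; ⁅_⁆; ∣_∣; ⊤)
open import Data.Vec using (_∷_; [])
open import Data.Bool using (true; false)
open import Data.Product using (Σ; ∃; _×_; _,_)
open import Data.Sum using (_⊎_)
open import Data.List using (List; []; _∷_)
open import Data.List.Membership.Propositional as LMem using ()
open import Data.List.Relation.Unary.Unique.Propositional using (Unique)
open import Data.List.Relation.Unary.AllPairs using (AllPairs)
open import Data.Rational using (ℚ; 0ℚ; 1ℚ; _+_; _*_; _≤_)
open import Relation.Nullary using (¬_)
open import Relation.Binary.PropositionalEquality using (_≡_)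
open import Function.Bundles using (_⇔_)

record WGraph : Set where
  field
    n      : ℕ
    m      : ℕ
    ends   : Fin m → Fin n × Fin n
    wt     : Fin m → ℚ
    wt≥0   : ∀ e → 0ℚ ≤ wt e

module _ (G : WGraph) where
  open WGraph G

  EdgeSet : Set
  EdgeSet = Subset m

  Vertex : Set
  Vertex = Fin n

  Joins : Fin m → Vertex → Vertex → Set
  Joins e u x = ends e ≡ (u , x) ⊎ ends e ≡ (x , u)

  data Walk (S : EdgeSet) : Vertex → Vertex → ℚ → Set where
    nil  : ∀ {u} → Walk S u u 0ℚ
    cons : ∀ {u x v d} (e : Fin m) → e ∈ S → Joins e u x →
           Walk S x v d → Walk S u v (wt e + d)

  -- dist_S(u,v) ≤ d  (dist is the minimum walk weight, ∞ if no walk)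
  Dist≤ : EdgeSet → Vertex → Vertex → ℚ → Set
  Dist≤ S u v d = ∃ λ d′ → Walk S u v d′ × d′ ≤ d

  _∖_ : EdgeSet → EdgeSet → EdgeSet
  S ∖ F = S ∩ ∁ F

  Connected : EdgeSet → Vertex → Vertex → Set
  Connected S u v = ∃ λ d → Walk S u v d

  IsEFTSpanner : ℚ → ℕ → EdgeSet → Set
  IsEFTSpanner k f H =
    ∀ (F : EdgeSet) → ∣ F ∣ ℕ.≤ f → ∀ (u v : Vertex) (d : ℚ) →
      Dist≤ (⊤ ∖ F) u v d → Dist≤ (H ∖ F) u v (k * d)

  IsEFTConnPreserver : ℕ → EdgeSet → Set
  IsEFTConnPreserver f′ Q =
    ∀ (F : EdgeSet) → ∣ F ∣ ℕ.≤ f′ → ∀ (u v : Vertex) →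
      Connected (Q ∖ F) u v ⇔ Connected (⊤ ∖ F) u v

  weightOf : EdgeSet → ℚ
  weightOf = go wt
    where
    go : ∀ {j} → (Fin j → ℚ) → Subset j → ℚ
    go {zero}  w []           = 0ℚ
    go {suc j} w (true  ∷ s)  = w Fin.zero + go (λ i → w (Fin.suc i)) s
    go {suc j} w (false ∷ s)  = go (λ i → w (Fin.suc i)) s

  IsMinWeightEFTConnPreserver : ℕ → EdgeSet → Set
  IsMinWeightEFTConnPreserver f′ Q =
    IsEFTConnPreserver f′ Q ×
    (∀ Q′ → IsEFTConnPreserver f′ Q′ → weightOf Q ≤ weightOf Q′)

  NeedsEdge : ℚ → ℕ → EdgeSet → Fin m → Set
  NeedsEdge k f H e =
    let (u , v) = ends e in
    ∃ λ (F : EdgeSet) → F ⊆ H × ∣ F ∣ ℕ.≤ f × ¬ Dist≤ (H ∖ F) u v (k * wt e)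

  -- Run k f H L H′ : processing the edges of the list L in order, starting
  -- from the current graph H, the greedy loop ends with H′.
  data Run (k : ℚ) (f : ℕ) : EdgeSet → List (Fin m) → EdgeSet → Set where
    done : ∀ {H} → Run k f H [] H
    add  : ∀ {H e L H′} → NeedsEdge k f H e →
           Run k f (H ∪ ⁅ e ⁆) L H′ → Run k f H (e ∷ L) H′
    skip : ∀ {H e L H′} → ¬ NeedsEdge k f H e →
           Run k f H L H′ → Run k f H (e ∷ L) H′

  -- H is a possible output of the Light Fault-Tolerant Greedy Spanner
  -- Algorithm on (G, k, f): for some minimum-weight 2f-EFT connectivity
  -- preserver Q and some nondecreasing-weight ordering L of E(G) ∖ Q.
  IsLightFTGreedyOutput : ℚ → ℕ → EdgeSet → Set
  IsLightFTGreedyOutput k f H =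
    ∃ λ (Q : EdgeSet) → ∃ λ (L : List (Fin m)) →
      IsMinWeightEFTConnPreserver (2 ℕ.* f) Q ×
      Unique L ×
      (∀ e → (e LMem.∈ L) ⇔ (e ∉ Q)) ×
      AllPairs (λ a b → wt a ≤ wt b) L ×
      Run k f Q L H

{-# OPTIONS --safe #-}
module Submission where

-- Every edge e ∉ F of G is k-spanned in H ∖ F: either e ∈ H, or the greedy loop rejected e
-- while its current graph was some H″ ⊆ H, so the fault set F ∩ H″ (of size ≤ f) still left
-- a walk in H″ ∖ F between the endpoints of e of weight ≤ k·w(e).  Replacing every edge of a walk
-- in G ∖ F by such a walk proves the spanner inequality.  Extracting a walk from a rejection
-- (a negated existential) needs dist_S(u,v) ≤ d to be decidable; it is, because shortest walks
-- may be taken simple and therefore have fewer than n edges.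

open import Defs
open import Data.Nat using (ℕ; zero; suc; z≤n; s≤s)
import Data.Nat as N
import Data.Nat.Properties as ℕ
open import Data.Fin using (Fin)
open import Data.Fin.Properties using (_≟_; any?; injective⇒≤)
open import Data.Fin.Subset using (_∈_; _∉_; _⊆_; ∁; _∩_; ∣_∣; ⊤)
open import Data.Fin.Subset.Properties
  using (_∈?_; p⊆p∪q; q⊆p∪q; x∈p∩q⁺; x∈p∩q⁻; x∈⁅x⁆; x∈∁p⇒x∉p; x∉p⇒x∈∁p; p∩q⊆q; ∣p∩q∣≤∣p∣)
open import Data.Rational using (ℚ; 0ℚ; 1ℚ; _+_; _*_; _≤_; nonNegative)
open import Data.Rational.Properties
  using (≤-refl; ≤-reflexive; ≤-trans; _≤?_; +-assoc; +-comm; +-identityˡ; +-identityʳ;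
         +-monoˡ-≤; +-monoʳ-≤; +-mono-≤; *-identityˡ; *-zeroʳ; *-distribˡ-+;
         *-monoʳ-≤-nonNeg; *-monoˡ-≤-nonNeg; nonNegative⁻¹)
open import Data.Product using (Σ; ∃; _×_; _,_; proj₁; proj₂)
open import Data.Product.Properties using (≡-dec)
open import Data.Sum using (_⊎_; inj₁; inj₂; swap)
open import Data.List using (List; _∷_)
import Data.List.Membership.Propositional as List
open import Data.List.Relation.Unary.Any using (here; there)
open import Data.Vec using (Vec; []; _∷_)
import Data.Vec.Membership.Propositional as Vec
import Data.Vec.Relation.Unary.Any as VecAny
open import Data.Vec.Relation.Unary.All using ([]; decide)
open import Data.Vec.Relation.Unary.Unique.Propositional using (Unique; []; _∷_)
open import Data.Vec.Relation.Unary.Unique.Propositional.Properties using (lookup-injective)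
open import Relation.Nullary using (¬_; Dec; yes; no)
open import Relation.Nullary.Decidable using (map; _×-dec_; _⊎-dec_; decidable-stable; toSum)
open import Relation.Binary.PropositionalEquality using (_≡_; refl; sym; subst)
open import Data.Empty using (⊥-elim)
open import Function.Bundles using (_⇔_; mk⇔; Equivalence)
open import Function.Properties.Equivalence using () renaming (sym to ⇔-sym)

p≤q+p : ∀ {p q} → 0ℚ ≤ q → p ≤ q + p
p≤q+p {p} {q} 0≤q = subst (_≤ q + p) (+-identityˡ p) (+-monoˡ-≤ p 0≤q)

p≤k*p : ∀ {k p} → 1ℚ ≤ k → 0ℚ ≤ p → p ≤ k * p
p≤k*p {k} {p} 1≤k 0≤p =
  subst (_≤ k * p) (*-identityˡ p) (*-monoʳ-≤-nonNeg p {{nonNegative 0≤p}} 1≤k)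

module _ (G : WGraph) where
  open WGraph G

  private variable
    A B H H′ H″ Q : EdgeSet G
    u v x y : Vertex G
    a b c d k : ℚ
    e : Fin m
    f : ℕ
    L : List (Fin m)

  Joins-sym : Joins G e u x → Joins G e x u
  Joins-sym = swap

  Joins-dec : ∀ e u x → Dec (Joins G e u x)
  Joins-dec e u x = ≡-dec _≟_ _≟_ (ends e) (u , x) ⊎-dec ≡-dec _≟_ _≟_ (ends e) (x , u)

  length : Walk G A u v d → ℕ
  length nil            = 0
  length (cons _ _ _ w) = suc (length w)

  vertices : (w : Walk G A u v d) → Vec (Vertex G) (suc (length w))
  vertices {u = u} nil            = u ∷ []
  vertices {u = u} (cons _ _ _ w) = u ∷ vertices w

  Simple : Walk G A u v d → Set
  Simple w = Unique (vertices w)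

  Walk-⊆ : A ⊆ B → Walk G A u v d → Walk G B u v d
  Walk-⊆ A⊆B nil            = nil
  Walk-⊆ A⊆B (cons e p j w) = cons e (A⊆B p) j (Walk-⊆ A⊆B w)

  _++ʷ_ : Walk G A u x a → Walk G A x v b → Walk G A u v (a + b)
  _++ʷ_ {b = b} nil w = subst (Walk G _ _ _) (sym (+-identityˡ b)) w
  _++ʷ_ {b = b} (cons {d = a} e p j w₁) w₂ =
    subst (Walk G _ _ _) (sym (+-assoc (wt e) a b)) (cons e p j (w₁ ++ʷ w₂))

  reverseʷ : Walk G A u v d → Walk G A v u d
  reverseʷ nil                     = nil
  reverseʷ (cons {d = d} e p j w) =
    subst (Walk G _ _ _) weight (reverseʷ w ++ʷ cons e p (Joins-sym j) nil)
    where
    weight : d + (wt e + 0ℚ) ≡ wt e + d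
    weight rewrite +-identityʳ (wt e) = +-comm d (wt e)

  Dist≤-⊆ : A ⊆ B → Dist≤ G A u v d → Dist≤ G B u v d
  Dist≤-⊆ A⊆B (d′ , w , d′≤d) = d′ , Walk-⊆ A⊆B w , d′≤d

  Dist≤-≤ : c ≤ d → Dist≤ G A u v c → Dist≤ G A u v d
  Dist≤-≤ c≤d (d′ , w , d′≤c) = d′ , w , ≤-trans d′≤c c≤d

  Dist≤-sym : Dist≤ G A u v d → Dist≤ G A v u d
  Dist≤-sym (d′ , w , d′≤d) = d′ , reverseʷ w , d′≤d

  Dist≤-triangle : Dist≤ G A u x a → Dist≤ G A x v b → Dist≤ G A u v (a + b)
  Dist≤-triangle (a′ , w₁ , a′≤a) (b′ , w₂ , b′≤b) = a′ + b′ , w₁ ++ʷ w₂ , +-mono-≤ a′≤a b′≤b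

  Spans : ℚ → EdgeSet G → Fin m → Set
  Spans k B e = Dist≤ G B (proj₁ (ends e)) (proj₂ (ends e)) (k * wt e)

  Spans-Joins : Spans k B e → Joins G e u x → Dist≤ G B u x (k * wt e)
  Spans-Joins {k} {B} {e} spans (inj₁ eq) =
    subst (λ (s , t) → Dist≤ G B s t (k * wt e)) eq spans
  Spans-Joins {k} {B} {e} spans (inj₂ eq) =
    Dist≤-sym (subst (λ (s , t) → Dist≤ G B s t (k * wt e)) eq spans)

  Walk-stretch : (∀ {e} → e ∈ A → Spans k B e) → Walk G A u v d → Dist≤ G B u v (k * d)
  Walk-stretch {k = k} spans nil = 0ℚ , nil , ≤-reflexive (sym (*-zeroʳ k))
  Walk-stretch {k = k} spans (cons {d = d} e p j w) =
    Dist≤-≤ (≤-reflexive (sym (*-distribˡ-+ k (wt e) d)))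
      (Dist≤-triangle (Spans-Joins {k = k} (spans p) j) (Walk-stretch {k = k} spans w))

  Dist≤-stretch : 0ℚ ≤ k → (∀ {e} → e ∈ A → Spans k B e) →
                  Dist≤ G A u v d → Dist≤ G B u v (k * d)
  Dist≤-stretch {k} 0≤k spans (d′ , w , d′≤d) =
    Dist≤-≤ (*-monoˡ-≤-nonNeg k {{nonNegative 0≤k}} d′≤d) (Walk-stretch {k = k} spans w)

  SimpleDist≤ : EdgeSet G → Vertex G → Vertex G → ℚ → Set
  SimpleDist≤ A u v d = ∃ λ d′ → Σ (Walk G A u v d′) λ w → Simple w × d′ ≤ d

  SimpleDist≤-≤ : c ≤ d → SimpleDist≤ A u v c → SimpleDist≤ A u v d
  SimpleDist≤-≤ c≤d (d′ , w , s , d′≤c) = d′ , w , s , ≤-trans d′≤c c≤d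

  suffix : (w : Walk G A y v d) → Simple w → x Vec.∈ vertices w → SimpleDist≤ A x v d
  suffix nil                s       (VecAny.here refl) = _ , nil , s , ≤-refl
  suffix w@(cons _ _ _ _)   s       (VecAny.here refl) = _ , w , s , ≤-refl
  suffix (cons e _ _ w)     (_ ∷ s) (VecAny.there x∈) = SimpleDist≤-≤ (p≤q+p (wt≥0 e)) (suffix w s x∈)

  simplify : Walk G A u v d → SimpleDist≤ A u v d
  simplify nil = _ , nil , [] ∷ [] , ≤-refl
  simplify {u = u} (cons e p j w) with simplify w
  ... | d′ , w′ , s , d′≤d with decide (λ y → swap (toSum (u ≟ y))) (vertices w′)
  ...   | inj₁ u∉w′ = _ , cons e p j w′ , u∉w′ ∷ s , +-monoʳ-≤ (wt e) d′≤d
  ...   | inj₂ u∈w′ = SimpleDist≤-≤ (≤-trans d′≤d (p≤q+p (wt≥0 e))) (suffix w′ s u∈w′)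

  Simple⇒length< : {w : Walk G A u v d} → Simple w → length w N.< n
  Simple⇒length< s = injective⇒≤ (λ {i} {j} → lookup-injective s i j)

  module _ (A : EdgeSet G) (v : Vertex G) (d : ℚ) where

    -- The remaining budget d − c is encoded as c + d′ ≤ d, which avoids subtraction.
    Reach : ℕ → ℚ → Vertex G → Set
    Reach ℓ c u = ∃ λ d′ → Σ (Walk G A u v d′) λ w → length w N.≤ ℓ × c + d′ ≤ d

    Stop : ℚ → Vertex G → Set
    Stop c u = u ≡ v × c + 0ℚ ≤ d

    Step : ℕ → ℚ → Vertex G → Set
    Step ℓ c u = ∃ λ e → e ∈ A × ∃ λ x → Joins G e u x × Reach ℓ (c + wt e) x

    Reach-zero : ∀ {c u} → Reach 0 c u ⇔ Stop c u
    Reach-zero = mk⇔ (λ { (_ , nil , _ , c≤d) → refl , c≤d })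
                     (λ { (refl , c≤d) → 0ℚ , nil , z≤n , c≤d })

    Reach-suc : ∀ {ℓ c u} → Reach (suc ℓ) c u ⇔ (Stop c u ⊎ Step ℓ c u)
    Reach-suc {ℓ} {c} = mk⇔ to from
      where
      to : ∀ {u} → Reach (suc ℓ) c u → Stop c u ⊎ Step ℓ c u
      to (_ , nil , _ , c≤d) = inj₁ (refl , c≤d)
      to (_ , cons {x = x} {d = d′} e p j w , s≤s ℓ≥ , c+d≤d) =
        inj₂ (e , p , x , j , d′ , w , ℓ≥ , subst (_≤ d) (sym (+-assoc c (wt e) d′)) c+d≤d)

      from : ∀ {u} → Stop c u ⊎ Step ℓ c u → Reach (suc ℓ) c u
      from (inj₁ (refl , c≤d)) = 0ℚ , nil , z≤n , c≤d
      from (inj₂ (e , p , x , j , d′ , w , ℓ≥ , c+d≤d)) =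
        _ , cons e p j w , s≤s ℓ≥ , subst (_≤ d) (+-assoc c (wt e) d′) c+d≤d

    Stop-dec : ∀ c u → Dec (Stop c u)
    Stop-dec c u = (u ≟ v) ×-dec (c + 0ℚ ≤? d)

    Reach-dec : ∀ ℓ c u → Dec (Reach ℓ c u)
    Reach-dec zero    c u = map (⇔-sym (Reach-zero {c} {u})) (Stop-dec c u)
    Reach-dec (suc ℓ) c u = map (⇔-sym (Reach-suc {ℓ} {c} {u})) (Stop-dec c u ⊎-dec
      any? λ e → (e ∈? A) ×-dec any? λ x → Joins-dec e u x ×-dec Reach-dec ℓ (c + wt e) x)

  Dist≤⇔Reach : Dist≤ G A u v d ⇔ Reach A v d n 0ℚ u
  Dist≤⇔Reach {d = d} = mk⇔ to from
    where
    to : Dist≤ G _ _ _ d → Reach _ _ d n 0ℚ _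
    to (_ , w , d′≤d) with simplify w
    ... | d″ , w′ , s , d″≤d′ = d″ , w′ , ℕ.<⇒≤ (Simple⇒length< s) ,
                                subst (_≤ d) (sym (+-identityˡ d″)) (≤-trans d″≤d′ d′≤d)

    from : Reach _ _ d n 0ℚ _ → Dist≤ G _ _ _ d
    from (d′ , w , _ , d′≤d) = d′ , w , subst (_≤ d) (+-identityˡ d′) d′≤d

  Dist≤-dec : ∀ A u v d → Dec (Dist≤ G A u v d)
  Dist≤-dec A u v d = map (⇔-sym Dist≤⇔Reach) (Reach-dec A v d n 0ℚ u)

  Run-⊆ : Run G k f H L H′ → H ⊆ H′
  Run-⊆ done          = λ e∈H → e∈H
  Run-⊆ (add _ run)   = λ e∈H → Run-⊆ run (p⊆p∪q _ e∈H)
  Run-⊆ (skip _ run)  = Run-⊆ run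

  Run-rejected : Run G k f H L H′ → e List.∈ L → e ∉ H′ →
                 ∃ λ H″ → H″ ⊆ H′ × ¬ NeedsEdge G k f H″ e
  Run-rejected {H = H} (add _ run) (here refl) e∉H′ =
    ⊥-elim (e∉H′ (Run-⊆ run (q⊆p∪q H _ (x∈⁅x⁆ _))))
  Run-rejected (add _ run)      (there e∈L) e∉H′ = Run-rejected run e∈L e∉H′
  Run-rejected {H = H} (skip ¬need run) (here refl) _ = H , Run-⊆ run , ¬need
  Run-rejected (skip _ run)     (there e∈L) e∉H′ = Run-rejected run e∈L e∉H′

  -- The rejection of e is tested against the faults F ∩ H″ inside H″, of which there are at most f.
  ¬NeedsEdge⇒Spans : ¬ NeedsEdge G k f H″ e → H″ ⊆ H → ∀ {F} → ∣ F ∣ N.≤ f → Spans k (H ∩ ∁ F) e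
  ¬NeedsEdge⇒Spans {k} {f} {H″} {e} {H} ¬need H″⊆H {F} ∣F∣≤f =
    Dist≤-⊆ restrict (decidable-stable (Dist≤-dec _ _ _ _) λ ¬spans →
      ¬need (F ∩ H″ , p∩q⊆q F H″ , ℕ.≤-trans (∣p∩q∣≤∣p∣ F H″) ∣F∣≤f , ¬spans))
    where
    restrict : H″ ∩ ∁ (F ∩ H″) ⊆ H ∩ ∁ F
    restrict x∈ = let x∈H″ , x∉F∩H″ = x∈p∩q⁻ H″ _ x∈ in
      x∈p∩q⁺ (H″⊆H x∈H″ , x∉p⇒x∈∁p λ x∈F → x∈∁p⇒x∉p x∉F∩H″ (x∈p∩q⁺ (x∈F , x∈H″)))

  Run-Spans : 1ℚ ≤ k → Run G k f Q L H → (∀ e → e ∉ Q → e List.∈ L) →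
              ∀ {F} → ∣ F ∣ N.≤ f → e ∉ F → Spans k (H ∩ ∁ F) e
  Run-Spans {k = k} {H = H} {e = e} 1≤k run ∁Q⊆L {F} ∣F∣≤f e∉F with e ∈? H
  ... | yes e∈H = Dist≤-≤ (p≤k*p 1≤k (wt≥0 e)) (wt e + 0ℚ , edge , ≤-reflexive (+-identityʳ (wt e)))
    where
    edge : Walk G (H ∩ ∁ F) (proj₁ (ends e)) (proj₂ (ends e)) (wt e + 0ℚ)
    edge = cons e (x∈p∩q⁺ (e∈H , x∉p⇒x∈∁p e∉F)) (inj₁ refl) nil
  ... | no e∉H =
    let _ , H″⊆H , ¬need = Run-rejected run (∁Q⊆L e (λ e∈Q → e∉H (Run-⊆ run e∈Q))) e∉H
    in ¬NeedsEdge⇒Spans {k = k} ¬need H″⊆H ∣F∣≤f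

theorem3p5 : (G : WGraph) (k : ℚ) (f : ℕ) → 1ℚ ≤ k → 1 N.≤ f →
    (H : EdgeSet G) → IsLightFTGreedyOutput G k f H → IsEFTSpanner G k f H
theorem3p5 G k f 1≤k _ H (Q , L , _ , _ , L⇔∁Q , _ , run) F ∣F∣≤f u v d =
  Dist≤-stretch G (≤-trans (nonNegative⁻¹ 1ℚ) 1≤k) λ e∈⊤∖F →
    Run-Spans G 1≤k run (λ e → Equivalence.from (L⇔∁Q e)) ∣F∣≤f
      (x∈∁p⇒x∉p (proj₂ (x∈p∩q⁻ ⊤ (∁ F) e∈⊤∖F)))
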